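{- Let $n\ge1$. The map sending a linear extension $(p_1,\dots,p_{3n})$ of the poset $V(n)$ to the word obtained by deleting the subscripts of the $p_i$ is a bijection from the set of linear extensions of $V(n)$ to the set of Kreweras words of length $3n$. Under this bijection, promotion of linear extensions of $V(n)$ corresponds to promotion of Kreweras words.
   Context: $V(n)$ is the poset on $\{\mathsf A_i,\mathsf B_i,\mathsf C_i:1\le i\le n\}$, the Cartesian product of the 3-element poset with $\mathsf A<\mathsf B$, $\mathsf A<\mathsf C$ ($\mathsf B,\mathsf C$ incomparable) and the chain $1<\dots<n$; i.e., $\mathsf X_i\le\mathsf Y_j$ iff $\mathsf X\le\mathsf Y$ in the 3-element poset and $i\le j$. A linear extension of a poset $P$ with $\ell$ elements is a list $(p_1,\dots,p_\ell)$ of all elements, each once, such that $p_i\le p_j$ implies $i\le j$. For $1\le i\le \ell-1$, $\tau_i$ swaps $p_i$ and $p_{i+1}$ if they are incomparable and otherwise does nothing; promotion of linear extensions is $\mathrm{pro}=\tau_{\ell-1}\circ\cdots\circ\tau_2\circ\tau_1$. A Kreweras word of length $3n$ is a word $w=(w_1,\dots,w_{3n})$ in letters $\mathsf A,\mathsf B,\mathsf C$ with $n$ of each letter such that every prefix has at least as many $\mathsf A$'s as $\mathsf B$'s and at least as many $\mathsf A$'s as $\mathsf C$'s. Its promotion: let $\iota(w)$ be the smallest $\iota\ge1$ with $(w_1,\dots,w_\iota)$ having as many $\mathsf A$'s as $\mathsf B$'s or as many $\mathsf A$'s as $\mathsf C$'s; $\mathrm{pro}(w)=(w_2,\dots,w_{\iota(w)-1},\mathsf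 A,w_{\iota(w)+1},\dots,w_{3n},w_{\iota(w)})$. -}

module Defs where

open import Data.Nat using (ℕ; zero; suc; _≤_; _∸_; _+_)
open import Data.Nat.Properties using (_≤?_)
open import Data.Fin using (Fin; toℕ)
open import Data.Fin.Properties using () renaming (_≟_ to _≟F_)
open import Data.Product using (_×_; _,_; proj₁)
open import Data.Sum using (_⊎_)
open import Data.Bool using (Bool; true; false; if_then_else_)
open import Data.List using (List; []; _∷_; _++_; length; take; drop; foldl; map; upTo; lookup)
open import Relation.Nullary using (Dec; yes; no; ¬_)
open import Relation.Nullary.Decidable using (_×-dec_; _⊎-dec_; ⌊_⌋)
open import Relation.Binary.PropositionalEquality using (_≡_; refl)
open import Data.List.Membership.Propositional using (_∈_)
open import Data.List.Relation.Unary.Unique.Propositional using (Unique)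

data Letter : Set where
  𝔸 𝔹 ℂ : Letter

data _≤L_ : Letter → Letter → Set where
  A≤A : 𝔸 ≤L 𝔸
  B≤B : 𝔹 ≤L 𝔹
  C≤C : ℂ ≤L ℂ
  A≤B : 𝔸 ≤L 𝔹
  A≤C : 𝔸 ≤L ℂ

_≤L?_ : (x y : Letter) → Dec (x ≤L y)
𝔸 ≤L? 𝔸 = yes A≤A
𝔸 ≤L? 𝔹 = yes A≤B
𝔸 ≤L? ℂ = yes A≤C
𝔹 ≤L? 𝔸 = no λ ()
𝔹 ≤L? 𝔹 = yes B≤B
𝔹 ≤L? ℂ = no λ ()
ℂ ≤L? 𝔸 = no λ ()
ℂ ≤L? 𝔹 = no λ ()
ℂ ≤L? ℂ = yes C≤C

_≟L_ : (x y : Letter) → Dec (x ≡ y)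
𝔸 ≟L 𝔸 = yes refl
𝔸 ≟L 𝔹 = no λ ()
𝔸 ≟L ℂ = no λ ()
𝔹 ≟L 𝔸 = no λ ()
𝔹 ≟L 𝔹 = yes refl
𝔹 ≟L ℂ = no λ ()
ℂ ≟L 𝔸 = no λ ()
ℂ ≟L 𝔹 = no λ ()
ℂ ≟L ℂ = yes refl

-- The poset V(n) = {A,B,C} × [n].  Element (X , i) with i : Fin n stands
-- for X_{i+1} (subscripts 1..n are encoded as Fin n = 0..n-1).

V : ℕ → Set
V n = Letter × Fin n

_≤V_ : ∀ {n} → V n → V n → Set
(x , i) ≤V (y , j) = (x ≤L y) × (toℕ i ≤ toℕ j)

_≤V?_ : ∀ {n} (p q : V n) → Dec (p ≤V q)
(x , i) ≤V? (y , j) = (x ≤L? y) ×-dec (toℕ i ≤? toℕ j)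

comparable? : ∀ {n} (p q : V n) → Dec ((p ≤V q) ⊎ (q ≤V p))
comparable? p q = (p ≤V? q) ⊎-dec (q ≤V? p)

record IsLinExt (n : ℕ) (l : List (V n)) : Set where
  field
    each-once : Unique l
    complete  : ∀ (p : V n) → p ∈ l
    order     : ∀ (i j : Fin (length l)) → lookup l i ≤V lookup l j → toℕ i ≤ toℕ j

-- τ_i (1-indexed): swap positions i and i+1 if incomparable, else do nothing.
τ : ∀ {n} → ℕ → List (V n) → List (V n)
τ (suc zero) (p ∷ q ∷ rest) with comparable? p q
... | yes _ = p ∷ q ∷ rest
... | no  _ = q ∷ p ∷ rest
τ (suc (suc i)) (p ∷ rest) = p ∷ τ (suc i) rest
τ _ l = l

-- pro = τ_{ℓ-1} ∘ ⋯ ∘ τ_2 ∘ τ_1  (τ_1 applied first)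
proV : ∀ {n} → List (V n) → List (V n)
proV l = foldl (λ acc i → τ i acc) l (map suc (upTo (length l ∸ 1)))

erase : ∀ {n} → List (V n) → List Letter
erase = map proj₁

count : Letter → List Letter → ℕ
count x [] = 0
count x (y ∷ w) with x ≟L y
... | yes _ = suc (count x w)
... | no  _ = count x w

record IsKreweras (n : ℕ) (w : List Letter) : Set where
  field
    countA : count 𝔸 w ≡ n
    countB : count 𝔹 w ≡ n
    countC : count ℂ w ≡ n
    prefB  : ∀ k → count 𝔹 (take k w) ≤ count 𝔸 (take k w)
    prefC  : ∀ k → count ℂ (take k w) ≤ count 𝔸 (take k w)

balanced? : List Letter → ℕ → Bool
balanced? w k = ⌊ (count 𝔸 (take k w) Data.Nat.≟ count 𝔹 (take k w))
                  ⊎-dec (count 𝔸 (take k w) Data.Nat.≟ count ℂ (take k w)) ⌋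

firstBalanced : List Letter → List ℕ → ℕ → ℕ
firstBalanced w [] d = d
firstBalanced w (k ∷ ks) d = if balanced? w k then k else firstBalanced w ks d

-- ι(w): smallest ι ≥ 1 such that the prefix of length ι is balanced
-- (search over 1..|w|; always found for Kreweras words, since w itself is balanced)
ι : List Letter → ℕ
ι w = firstBalanced w (map suc (upTo (length w))) (length w)

-- pro(w) = (w_2, …, w_{ι-1}, A, w_{ι+1}, …, w_{3n}, w_ι)
proK : List Letter → List Letter
proK w = drop 1 (take (ι w ∸ 1) w) ++ (𝔸 ∷ (drop (ι w) w ++ take 1 (drop (ι w ∸ 1) w)))

-- The elements of V(n) already listed in a prefix of a linear extension form an order
-- ideal, recorded by the number κ X of elements X_i listed so far for each letter X.
-- The next element must be a minimal element of the complement, i.e. some X_{κ X + 1}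
-- whose predecessor A_{κ X + 1} has been listed (κ X < κ A when X ≠ A). Hence a linear
-- extension is determined by its word, which must be a Kreweras word; conversely
-- subscripting the k-th occurrence of each letter of a Kreweras word by k gives a linear
-- extension.
--
-- Under promotion the element being moved is replaced by the first element above it:
-- A_1 is stopped by A_2, which is stopped by A_3, and so on, until the current A_k meets
-- B_k or C_k. That happens exactly at the first prefix with as many A's as B's or C's,
-- and from there B_k (or C_k) slides past everything to the end. After erasing
-- subscripts, the leading A reappears just before position ι and w_ι moves to the end,
-- which is promotion of Kreweras words.
module Submission where

open import Defs
open import Data.Nat
  using (ℕ; zero; suc; _≤_; _<_; _∸_; _+_; _≟_; z≤n; s≤s; z<s; s<s; NonZero; >-nonZero; ≢-nonZero⁻¹)
open import Data.Nat.Properties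
open import Data.Nat.DivMod using (_mod_; m<n⇒m%n≡m)
open import Data.Fin using (Fin; toℕ; zero; suc)
open import Data.Fin.Properties using (toℕ<n; toℕ-injective; toℕ-fromℕ<)
open import Data.List using (List; []; _∷_; _++_; length; take; drop; foldl; applyUpTo; lookup)
open import Data.List.Properties using (map-upTo)
open import Data.List.Relation.Unary.All using (All; []; _∷_)
import Data.List.Relation.Unary.All as All
open import Data.List.Relation.Unary.AllPairs using (AllPairs; []; _∷_)
import Data.List.Relation.Unary.AllPairs as AllPairs
open import Data.List.Relation.Unary.Any using (here; there)
import Data.List.Relation.Unary.Any as Any
open import Data.List.Relation.Unary.Any.Properties using (¬Any[]; lookup-index)
open import Data.List.Membership.Propositional using (_∈_)
open import Data.List.Membership.Propositional.Properties using (∈-lookup)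
open import Data.List.Relation.Unary.Unique.Propositional using (Unique)
open import Data.Product using (_×_; Σ; _,_; proj₁; proj₂)
open import Data.Sum using (_⊎_; inj₁; inj₂; [_,_]′)
open import Data.Bool using (true; false)
open import Function using (_∘_; id)
open import Relation.Nullary using (Dec; yes; no; ¬_; contradiction)
open import Relation.Nullary.Decidable using (_⊎-dec_; isYes≗does; dec-true; dec-false; decidable-stable)
open import Relation.Binary.PropositionalEquality
  using (_≡_; _≢_; refl; sym; trans; cong; cong₂; subst; subst₂; module ≡-Reasoning)

module _ {A : Set} (_≼_ : A → A → Set) where

  Ordered : List A → Set
  Ordered = AllPairs (λ p q → ¬ q ≼ p)

  Ordered⇒order : ∀ {l} → Ordered l →
                  ∀ (i j : Fin (length l)) → lookup l i ≼ lookup l j → toℕ i ≤ toℕ j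
  Ordered⇒order (_ ∷ _) zero    _       _   = z≤n
  Ordered⇒order (h ∷ _) (suc i) zero    i≼j = contradiction i≼j (All.lookup h (∈-lookup i))
  Ordered⇒order (_ ∷ o) (suc i) (suc j) i≼j = s≤s (Ordered⇒order o i j i≼j)

  order⇒Ordered : ∀ {l} → (∀ (i j : Fin (length l)) → lookup l i ≼ lookup l j → toℕ i ≤ toℕ j) →
                  Ordered l
  order⇒Ordered {[]}    _     = []
  order⇒Ordered {x ∷ l} order =
    All.tabulate (λ q∈l q≼x → contradiction (order (suc (Any.index q∈l)) zero
                                              (subst (_≼ x) (lookup-index q∈l) q≼x)) λ ())
    ∷ order⇒Ordered (λ i j i≼j → ≤-pred (order (suc i) (suc j) i≼j))

  Ordered⇒Unique : (∀ {p} → p ≼ p) → ∀ {l} → Ordered l → Unique l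
  Ordered⇒Unique ≼-refl = AllPairs.map (λ {p} q⋠p p≡q → q⋠p (subst (_≼ p) p≡q ≼-refl))

≤L-refl : ∀ {x} → x ≤L x
≤L-refl {𝔸} = A≤A
≤L-refl {𝔹} = B≤B
≤L-refl {ℂ} = C≤C

𝔸≤L : ∀ x → 𝔸 ≤L x
𝔸≤L 𝔸 = A≤A
𝔸≤L 𝔹 = A≤B
𝔸≤L ℂ = A≤C

≤L-cases : ∀ {y x} → y ≤L x → y ≡ x ⊎ (y ≡ 𝔸 × x ≢ 𝔸)
≤L-cases A≤A = inj₁ refl
≤L-cases B≤B = inj₁ refl
≤L-cases C≤C = inj₁ refl
≤L-cases A≤B = inj₂ (refl , λ ())
≤L-cases A≤C = inj₂ (refl , λ ())

≤V-refl : ∀ {n} {p : V n} → p ≤V p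
≤V-refl = ≤L-refl , ≤-refl

Counts : Set
Counts = Letter → ℕ

initial : Counts
initial _ = 0

tick : Letter → Counts → Counts
tick x κ y with y ≟L x
... | yes _ = suc (κ y)
... | no  _ = κ y

tick-same : ∀ x κ → tick x κ x ≡ suc (κ x)
tick-same x κ with x ≟L x
... | yes _   = refl
... | no  x≢x = contradiction refl x≢x

tick-other : ∀ {x y} κ → y ≢ x → tick x κ y ≡ κ y
tick-other {x} {y} κ y≢x with y ≟L x
... | yes y≡x = contradiction y≡x y≢x
... | no  _   = refl

≤-tick : ∀ x κ y → κ y ≤ tick x κ y
≤-tick x κ y with y ≟L x
... | yes _ = n≤1+n (κ y)
... | no  _ = ≤-refl

tick-≤ : ∀ {x κ m} → κ x < m → (∀ X → κ X ≤ m) → ∀ X → tick x κ X ≤ m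
tick-≤ {x} κx<m κ≤m X with X ≟L x
... | yes refl = κx<m
... | no  _    = κ≤m X

after : Counts → List Letter → Counts
after κ []      = κ
after κ (x ∷ w) = after (tick x κ) w

after-count : ∀ κ w X → after κ w X ≡ κ X + count X w
after-count κ []      X = sym (+-identityʳ (κ X))
after-count κ (x ∷ w) X = trans (after-count (tick x κ) w X) tick-count
  where
    tick-count : tick x κ X + count X w ≡ κ X + count X (x ∷ w)
    tick-count with X ≟L x
    ... | yes _ = sym (+-suc (κ X) (count X w))
    ... | no  _ = refl

Ballot : Counts → Set
Ballot κ = κ 𝔹 ≤ κ 𝔸 × κ ℂ ≤ κ 𝔸

Ballot-resp : ∀ {κ κ′} → (∀ X → κ X ≡ κ′ X) → Ballot κ → Ballot κ′
Ballot-resp κ≗κ′ (b , c) =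
  subst₂ _≤_ (κ≗κ′ 𝔹) (κ≗κ′ 𝔸) b , subst₂ _≤_ (κ≗κ′ ℂ) (κ≗κ′ 𝔸) c

Step : Letter → Counts → Set
Step x κ = x ≢ 𝔸 → κ x < κ 𝔸

Ballot-tick : ∀ {x κ} → Ballot κ → Step x κ → Ballot (tick x κ)
Ballot-tick {𝔸} (b , c) _    = m≤n⇒m≤1+n b , m≤n⇒m≤1+n c
Ballot-tick {𝔹} (_ , c) step = step (λ ()) , c
Ballot-tick {ℂ} (b , _) step = b , step (λ ())

Ballot-tick⇒Step : ∀ {x κ} → Ballot (tick x κ) → Step x κ
Ballot-tick⇒Step {𝔸} _       𝔸≢𝔸 = contradiction refl 𝔸≢𝔸
Ballot-tick⇒Step {𝔹} (b , _) _   = b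
Ballot-tick⇒Step {ℂ} (_ , c) _   = c

StrictBallot : Counts → Set
StrictBallot κ = ∀ X → X ≢ 𝔸 → κ X < κ 𝔸

StrictBallot-𝔸 : StrictBallot (tick 𝔸 initial)
StrictBallot-𝔸 𝔸 𝔸≢𝔸 = contradiction refl 𝔸≢𝔸
StrictBallot-𝔸 𝔹 _   = s≤s z≤n
StrictBallot-𝔸 ℂ _   = s≤s z≤n

StrictBallot-tick : ∀ {x κ} → StrictBallot κ → (x ≢ 𝔸 → suc (κ x) < κ 𝔸) → StrictBallot (tick x κ)
StrictBallot-tick {x} {κ} strict widens Y Y≢𝔸 with Y ≟L x
... | yes refl = subst (suc (κ Y) <_) (sym (tick-other κ (Y≢𝔸 ∘ sym))) (widens Y≢𝔸)
... | no  _    = <-≤-trans (strict Y Y≢𝔸) (≤-tick x κ 𝔸)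

Balanced : Counts → Set
Balanced κ = κ 𝔸 ≡ κ 𝔹 ⊎ κ 𝔸 ≡ κ ℂ

Balanced? : ∀ κ → Dec (Balanced κ)
Balanced? κ = (κ 𝔸 ≟ κ 𝔹) ⊎-dec (κ 𝔸 ≟ κ ℂ)

Balanced-resp : ∀ {κ κ′} → (∀ X → κ X ≡ κ′ X) → Balanced κ → Balanced κ′
Balanced-resp κ≗κ′ (inj₁ ab) = inj₁ (trans (sym (κ≗κ′ 𝔸)) (trans ab (κ≗κ′ 𝔹)))
Balanced-resp κ≗κ′ (inj₂ ac) = inj₂ (trans (sym (κ≗κ′ 𝔸)) (trans ac (κ≗κ′ ℂ)))

StrictBallot⇒¬Balanced : ∀ {κ} → StrictBallot κ → ¬ Balanced κ
StrictBallot⇒¬Balanced strict (inj₁ ab) = <-irrefl (sym ab) (strict 𝔹 λ ())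
StrictBallot⇒¬Balanced strict (inj₂ ac) = <-irrefl (sym ac) (strict ℂ λ ())

balanced?-true : ∀ w k → Balanced (after initial (take k w)) → balanced? w k ≡ true
balanced?-true w k bal = trans (isYes≗does d) (dec-true d (Balanced-resp (after-count initial (take k w)) bal))
  where
    d : Dec (Balanced λ X → count X (take k w))
    d = Balanced? λ X → count X (take k w)

balanced?-false : ∀ w k → ¬ Balanced (after initial (take k w)) → balanced? w k ≡ false
balanced?-false w k ¬bal =
  trans (isYes≗does d) (dec-false d (¬bal ∘ Balanced-resp (sym ∘ after-count initial (take k w))))
  where
    d : Dec (Balanced λ X → count X (take k w))
    d = Balanced? λ X → count X (take k w)

firstBalanced-applyUpTo : ∀ w f L d i → i < L → balanced? w (f i) ≡ true →
                          (∀ j → j < i → balanced? w (f j) ≡ false) →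
                          firstBalanced w (applyUpTo f L) d ≡ f i
firstBalanced-applyUpTo w f (suc L) d zero    _           hit _    rewrite hit = refl
firstBalanced-applyUpTo w f (suc L) d (suc i) (s≤s i<L) hit miss rewrite miss 0 z<s =
  firstBalanced-applyUpTo w (f ∘ suc) L d i i<L hit (λ j j<i → miss (suc j) (s<s j<i))

Closes : Letter → Counts → Set
Closes X κ = X ≢ 𝔸 × suc (κ X) ≡ κ 𝔸

Closes⇒Balanced : ∀ {X κ} → Closes X κ → Balanced (tick X κ)
Closes⇒Balanced {𝔸} (𝔸≢𝔸 , _) = contradiction refl 𝔸≢𝔸
Closes⇒Balanced {𝔹} (_ , e)   = inj₁ (sym e)
Closes⇒Balanced {ℂ} (_ , e)   = inj₂ (sym e)

-- FirstBalance κ u splits u as v ++ X ∷ t, where reading v from κ keeps every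
-- non-A count strictly below the A count and reading X then closes the gap.
data FirstBalance (κ : Counts) : List Letter → Set where
  closes-now : ∀ {X t} → Closes X κ → FirstBalance κ (X ∷ t)
  strict-∷   : ∀ {x u} → StrictBallot (tick x κ) → FirstBalance (tick x κ) u → FirstBalance κ (x ∷ u)

gap : ∀ {κ u} → FirstBalance κ u → ℕ
gap (closes-now _)  = 0
gap (strict-∷ _ fb) = suc (gap fb)

promoted : ∀ {κ u} → FirstBalance κ u → List Letter
promoted (closes-now {X} {t} _) = 𝔸 ∷ (t ++ X ∷ [])
promoted (strict-∷ {x} _ fb)    = x ∷ promoted fb

gap<length : ∀ {κ u} (fb : FirstBalance κ u) → gap fb < length u
gap<length (closes-now _)  = z<s
gap<length (strict-∷ _ fb) = s<s (gap<length fb)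

FirstBalance-strict : ∀ {κ u} → StrictBallot κ → (fb : FirstBalance κ u) →
                      ∀ j → j ≤ gap fb → StrictBallot (after κ (take j u))
FirstBalance-strict strict _                 zero    _         = strict
FirstBalance-strict _      (strict-∷ s′ fb)  (suc j) (s≤s j≤g) = FirstBalance-strict s′ fb j j≤g

FirstBalance-balanced : ∀ {κ u} (fb : FirstBalance κ u) → Balanced (after κ (take (suc (gap fb)) u))
FirstBalance-balanced (closes-now closes) = Closes⇒Balanced closes
FirstBalance-balanced (strict-∷ _ fb)     = FirstBalance-balanced fb

promoted-take-drop : ∀ {κ u} (fb : FirstBalance κ u) →
                     promoted fb ≡ take (gap fb) u ++ 𝔸 ∷ (drop (suc (gap fb)) u ++ take 1 (drop (gap fb) u))
promoted-take-drop (closes-now _)       = refl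
promoted-take-drop (strict-∷ {x} _ fb) = cong (x ∷_) (promoted-take-drop fb)

ι-𝔸∷ : ∀ {u} (fb : FirstBalance (tick 𝔸 initial) u) → ι (𝔸 ∷ u) ≡ suc (suc (gap fb))
ι-𝔸∷ {u} fb = begin
  ι w
    ≡⟨ cong (λ ks → firstBalanced w ks (length w)) (map-upTo suc (length w)) ⟩
  firstBalanced w (applyUpTo suc (length w)) (length w)
    ≡⟨ firstBalanced-applyUpTo w suc (length w) (length w) (suc (gap fb)) (s<s (gap<length fb)) hit miss ⟩
  suc (suc (gap fb))
    ∎
  where
    open ≡-Reasoning
    w : List Letter
    w = 𝔸 ∷ u
    hit : balanced? w (suc (suc (gap fb))) ≡ true
    hit = balanced?-true w (suc (suc (gap fb))) (FirstBalance-balanced fb)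
    miss : ∀ j → j < suc (gap fb) → balanced? w (suc j) ≡ false
    miss j j<1+g = balanced?-false w (suc j)
      (StrictBallot⇒¬Balanced (FirstBalance-strict StrictBallot-𝔸 fb j (≤-pred j<1+g)))

proK-𝔸∷ : ∀ {u} (fb : FirstBalance (tick 𝔸 initial) u) → proK (𝔸 ∷ u) ≡ promoted fb
proK-𝔸∷ {u} fb = trans (cong (proK-at (𝔸 ∷ u)) (ι-𝔸∷ fb)) (sym (promoted-take-drop fb))
  where
    proK-at : List Letter → ℕ → List Letter
    proK-at w k = drop 1 (take (k ∸ 1) w) ++ (𝔸 ∷ (drop k w ++ take 1 (drop (k ∸ 1) w)))

slide : ∀ {n} → V n → List (V n) → List (V n)
slide p []      = p ∷ []
slide p (q ∷ r) with comparable? p q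
... | yes _ = p ∷ slide q r
... | no  _ = q ∷ slide p r

foldl-τ-∷ : ∀ {n} (f : ℕ → ℕ) k (x : V n) t →
            foldl (λ l i → τ i l) (x ∷ t) (applyUpTo (λ i → suc (suc (f i))) k)
            ≡ x ∷ foldl (λ l i → τ i l) t (applyUpTo (λ i → suc (f i)) k)
foldl-τ-∷ f zero    x t = refl
foldl-τ-∷ f (suc k) x t = foldl-τ-∷ (f ∘ suc) k x (τ (suc (f 0)) t)

foldl-τ-slide : ∀ {n} (p : V n) r → foldl (λ l i → τ i l) (p ∷ r) (applyUpTo suc (length r)) ≡ slide p r
foldl-τ-slide p []      = refl
foldl-τ-slide p (q ∷ r) with comparable? p q
... | yes _ = trans (foldl-τ-∷ id (length r) p (q ∷ r)) (cong (p ∷_) (foldl-τ-slide q r))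
... | no  _ = trans (foldl-τ-∷ id (length r) q (p ∷ r)) (cong (q ∷_) (foldl-τ-slide p r))

proV-∷ : ∀ {n} (p : V n) r → proV (p ∷ r) ≡ slide p r
proV-∷ p r = trans (cong (foldl (λ l i → τ i l) (p ∷ r)) (map-upTo suc (length r))) (foldl-τ-slide p r)

slide-comparable : ∀ {n} {p q : V n} r → (p ≤V q ⊎ q ≤V p) → slide p (q ∷ r) ≡ p ∷ slide q r
slide-comparable {p = p} {q} r p∼q with comparable? p q
... | yes _   = refl
... | no  p≁q = contradiction p∼q p≁q

slide-incomparable : ∀ {n} {p q : V n} r → ¬ (p ≤V q ⊎ q ≤V p) → slide p (q ∷ r) ≡ q ∷ slide p r
slide-incomparable {p = p} {q} r p≁q with comparable? p q
... | yes p∼q = contradiction p∼q p≁q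
... | no  _   = refl

Above : ∀ {n} → Counts → V n → Set
Above κ p = κ (proj₁ p) ≤ toℕ (proj₂ p)

Above-tick⇒Above : ∀ {n x κ} {q : V n} → Above (tick x κ) q → Above κ q
Above-tick⇒Above {x = x} {κ} {q} = ≤-trans (≤-tick x κ (proj₁ q))

Above⇒head⊎Above-tick : ∀ {n x κ} {j : Fin n} {q} → toℕ j ≡ κ x → Above κ q →
                        q ≡ (x , j) ⊎ Above (tick x κ) q
Above⇒head⊎Above-tick {x = x} {κ} {j} {Y , i} j≡κx κY≤i with Y ≟L x
... | no _ = inj₂ κY≤i
... | yes refl with toℕ i ≟ κ Y
...   | yes i≡κY = inj₁ (cong (Y ,_) (toℕ-injective (trans i≡κY (sym j≡κx))))
...   | no  i≢κY = inj₂ (≤∧≢⇒< κY≤i (i≢κY ∘ sym))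

Above-tick⇒≰ : ∀ {n x κ} {j : Fin n} {q} → Step x κ → toℕ j ≡ κ x →
               Above (tick x κ) q → ¬ q ≤V (x , j)
Above-tick⇒≰ {x = x} {κ} {j} {Y , i} step j≡κx above (Y≤x , i≤j) with ≤L-cases Y≤x
... | inj₁ refl = <⇒≱ (subst (_≤ toℕ i) (tick-same Y κ) above) (≤-trans i≤j (≤-reflexive j≡κx))
... | inj₂ (refl , x≢𝔸) =
  <⇒≱ (step x≢𝔸) (≤-trans (subst (_≤ toℕ i) (tick-other κ (x≢𝔸 ∘ sym)) above)
                          (≤-trans i≤j (≤-reflexive j≡κx)))

module Labelling (n : ℕ) .{{_ : NonZero n}} where

  -- Subscripts are only ever below n here, so the reduction mod n never wraps around.
  cell : Letter → ℕ → V n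
  cell X i = X , i mod n

  toℕ-mod : ∀ {i} → i < n → toℕ (i mod n) ≡ i
  toℕ-mod {i} i<n = trans (toℕ-fromℕ< _) (m<n⇒m%n≡m i<n)

  cell-≤V : ∀ {X Y i j} → X ≤L Y → i ≤ j → j < n → cell X i ≤V cell Y j
  cell-≤V X≤Y i≤j j<n = X≤Y , subst₂ _≤_ (sym (toℕ-mod (≤-<-trans i≤j j<n))) (sym (toℕ-mod j<n)) i≤j

  cell-≤V⁻¹ : ∀ {X Y i j} → i < n → j < n → cell X i ≤V cell Y j → i ≤ j
  cell-≤V⁻¹ i<n j<n (_ , i≤j) = subst₂ _≤_ (toℕ-mod i<n) (toℕ-mod j<n) i≤j

  label : Counts → List Letter → List (V n)
  label κ []      = []
  label κ (x ∷ w) = cell x (κ x) ∷ label (tick x κ) w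

  erase-label : ∀ κ w → erase (label κ w) ≡ w
  erase-label κ []      = refl
  erase-label κ (x ∷ w) = cong (x ∷_) (erase-label (tick x κ) w)

  KrewerasFrom : Counts → List Letter → Set
  KrewerasFrom κ []      = ∀ X → κ X ≡ n
  KrewerasFrom κ (x ∷ w) = Step x κ × KrewerasFrom (tick x κ) w

  KrewerasFrom-bounded : ∀ {κ} w → KrewerasFrom κ w → ∀ X → κ X ≤ n
  KrewerasFrom-bounded     []      total    X = ≤-reflexive (total X)
  KrewerasFrom-bounded {κ} (x ∷ w) (_ , kw) X = ≤-trans (≤-tick x κ X) (KrewerasFrom-bounded w kw X)

  KrewerasFrom-head< : ∀ {κ x} w → KrewerasFrom κ (x ∷ w) → κ x < n
  KrewerasFrom-head< {κ} {x} w (_ , kw) = subst (_≤ n) (tick-same x κ) (KrewerasFrom-bounded w kw x)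

  record IsKrewerasFrom (κ : Counts) (w : List Letter) : Set where
    field
      totals   : ∀ X → after κ w X ≡ n
      prefixes : ∀ k → Ballot (after κ (take k w))

  KrewerasFrom⇒IsKrewerasFrom : ∀ {κ} w → Ballot κ → KrewerasFrom κ w → IsKrewerasFrom κ w
  KrewerasFrom⇒IsKrewerasFrom []      b total =
    record { totals = total ; prefixes = λ { zero → b ; (suc _) → b } }
  KrewerasFrom⇒IsKrewerasFrom (x ∷ w) b (step , kw) =
    record { totals = totals ; prefixes = λ { zero → b ; (suc k) → prefixes k } }
    where open IsKrewerasFrom (KrewerasFrom⇒IsKrewerasFrom w (Ballot-tick b step) kw)

  IsKrewerasFrom⇒KrewerasFrom : ∀ {κ} w → IsKrewerasFrom κ w → KrewerasFrom κ w
  IsKrewerasFrom⇒KrewerasFrom []      K = IsKrewerasFrom.totals K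
  IsKrewerasFrom⇒KrewerasFrom (x ∷ w) K =
    Ballot-tick⇒Step (prefixes 1) ,
    IsKrewerasFrom⇒KrewerasFrom w (record { totals = totals ; prefixes = prefixes ∘ suc })
    where open IsKrewerasFrom K

  IsKreweras⇒KrewerasFrom : ∀ {w} → IsKreweras n w → KrewerasFrom initial w
  IsKreweras⇒KrewerasFrom {w} K = IsKrewerasFrom⇒KrewerasFrom w (record
    { totals   = λ X → trans (after-count initial w X) (counted X)
    ; prefixes = λ k → Ballot-resp (sym ∘ after-count initial (take k w)) (prefB k , prefC k) })
    where
      open IsKreweras K
      counted : ∀ X → count X w ≡ n
      counted 𝔸 = countA
      counted 𝔹 = countB
      counted ℂ = countC

  KrewerasFrom⇒IsKreweras : ∀ {w} → KrewerasFrom initial w → IsKreweras n w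
  KrewerasFrom⇒IsKreweras {w} kw = record
    { countA = counted 𝔸 ; countB = counted 𝔹 ; countC = counted ℂ
    ; prefB  = proj₁ ∘ ballot ; prefC = proj₂ ∘ ballot }
    where
      open IsKrewerasFrom (KrewerasFrom⇒IsKrewerasFrom w (z≤n , z≤n) kw)
      counted : ∀ X → count X w ≡ n
      counted X = trans (sym (after-count initial w X)) (totals X)
      ballot : ∀ k → Ballot (λ X → count X (take k w))
      ballot k = Ballot-resp (after-count initial (take k w)) (prefixes k)

  -- κ records the order ideal {(X , i) : i < κ X} of elements already listed; l lists
  -- the rest, compatibly with the order.
  record LinExtAbove (κ : Counts) (l : List (V n)) : Set where
    field
      ordered : Ordered _≤V_ l
      above   : All (Above κ) l
      covers  : ∀ p → Above κ p → p ∈ l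
      bounded : ∀ X → κ X ≤ n

  LinExtAbove-[] : ∀ {κ} → (∀ X → κ X ≡ n) → LinExtAbove κ []
  LinExtAbove-[] total = record
    { ordered = []
    ; above   = []
    ; covers  = λ { (X , j) κX≤j → contradiction (subst (_≤ toℕ j) (total X) κX≤j) (<⇒≱ (toℕ<n j)) }
    ; bounded = ≤-reflexive ∘ total }

  LinExtAbove-[]⁻ : ∀ {κ} → LinExtAbove κ [] → ∀ X → κ X ≡ n
  LinExtAbove-[]⁻ {κ} L X =
    ≤-antisym (bounded X) (≮⇒≥ λ κX<n → ¬Any[] (covers (cell X (κ X)) (≤-reflexive (sym (toℕ-mod κX<n)))))
    where open LinExtAbove L

  LinExtAbove-∷ : ∀ {κ x l} → Step x κ → κ x < n → LinExtAbove (tick x κ) l →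
                  LinExtAbove κ (cell x (κ x) ∷ l)
  LinExtAbove-∷ {κ} {x} step κx<n L = record
    { ordered = All.map (Above-tick⇒≰ step j≡κx) above ∷ ordered
    ; above   = ≤-reflexive (sym j≡κx) ∷ All.map (λ {q} → Above-tick⇒Above {x = x} {κ} {q}) above
    ; covers  = λ q κ≤q → [ here , there ∘ covers q ]′ (Above⇒head⊎Above-tick j≡κx κ≤q)
    ; bounded = λ X → ≤-trans (≤-tick x κ X) (bounded X) }
    where
      open LinExtAbove L
      j≡κx : toℕ (κ x mod n) ≡ κ x
      j≡κx = toℕ-mod κx<n

  LinExtAbove-∷⁻ : ∀ {κ x j l} → LinExtAbove κ ((x , j) ∷ l) →
                   toℕ j ≡ κ x × Step x κ × LinExtAbove (tick x κ) l
  LinExtAbove-∷⁻ {κ} {x} {j} {l} L = j≡κx , step , record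
    { ordered = AllPairs.tail ordered
    ; above   = All.zipWith above-tick (All.tail above , AllPairs.head ordered)
    ; covers  = λ q above-q → Any.tail (head-not-above ∘ λ q≡ → subst (Above (tick x κ)) q≡ above-q)
                                       (covers q (Above-tick⇒Above {x = x} {κ} {q} above-q))
    ; bounded = tick-≤ (subst (_< n) j≡κx (toℕ<n j)) bounded }
    where
      open LinExtAbove L
      minimal : ∀ {q} → q ∈ (x , j) ∷ l → q ≤V (x , j) → q ≡ (x , j)
      minimal (here q≡)   _   = q≡
      minimal (there q∈l) q≤p = contradiction q≤p (All.lookup (AllPairs.head ordered) q∈l)
      pinned : ∀ Y → Y ≤L x → κ Y ≤ toℕ j → cell Y (κ Y) ≡ (x , j)
      pinned Y Y≤x κY≤j = minimal (covers _ (≤-reflexive (sym e))) (Y≤x , ≤-trans (≤-reflexive e) κY≤j)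
        where
          e : toℕ (κ Y mod n) ≡ κ Y
          e = toℕ-mod (≤-<-trans κY≤j (toℕ<n j))
      κx≤j : κ x ≤ toℕ j
      κx≤j = All.head above
      j≡κx : toℕ j ≡ κ x
      j≡κx = trans (sym (cong (toℕ ∘ proj₂) (pinned x ≤L-refl κx≤j)))
                   (toℕ-mod (≤-<-trans κx≤j (toℕ<n j)))
      step : Step x κ
      step x≢𝔸 = decidable-stable (κ x <? κ 𝔸) (λ κx≮κ𝔸 → x≢𝔸 (sym (𝔸≡x (≮⇒≥ κx≮κ𝔸))))
        where
          𝔸≡x : κ 𝔸 ≤ κ x → 𝔸 ≡ x
          𝔸≡x κ𝔸≤κx = cong proj₁ (pinned 𝔸 (𝔸≤L x) (≤-trans κ𝔸≤κx (≤-reflexive (sym j≡κx))))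
      head-not-above : ¬ Above (tick x κ) (x , j)
      head-not-above a = <-irrefl (sym j≡κx) (subst (_≤ toℕ j) (tick-same x κ) a)
      above-tick : ∀ {q} → Above κ q × ¬ q ≤V (x , j) → Above (tick x κ) q
      above-tick (above-q , q≰p) =
        [ (λ q≡ → contradiction (subst (_≤V (x , j)) (sym q≡) ≤V-refl) q≰p) , id ]′
          (Above⇒head⊎Above-tick j≡κx above-q)

  LinExtAbove⇒label : ∀ {κ} l → LinExtAbove κ l → l ≡ label κ (erase l) × KrewerasFrom κ (erase l)
  LinExtAbove⇒label     []            L = refl , LinExtAbove-[]⁻ L
  LinExtAbove⇒label {κ} ((x , j) ∷ l) L with LinExtAbove-∷⁻ L
  ... | j≡κx , step , L′ with LinExtAbove⇒label l L′
  ...   | l≡ , kw = cong₂ _∷_ (cong (x ,_) j≡) l≡ , step , kw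
    where
      j≡ : j ≡ κ x mod n
      j≡ = toℕ-injective (trans j≡κx (sym (toℕ-mod (subst (_< n) j≡κx (toℕ<n j)))))

  label-LinExtAbove : ∀ {κ} w → KrewerasFrom κ w → LinExtAbove κ (label κ w)
  label-LinExtAbove []      total = LinExtAbove-[] total
  label-LinExtAbove (x ∷ w) kw    =
    LinExtAbove-∷ (proj₁ kw) (KrewerasFrom-head< w kw) (label-LinExtAbove w (proj₂ kw))

  IsLinExt⇒LinExtAbove : ∀ {l} → IsLinExt n l → LinExtAbove initial l
  IsLinExt⇒LinExtAbove le = record
    { ordered = order⇒Ordered _≤V_ order
    ; above   = All.tabulate λ _ → z≤n
    ; covers  = λ p _ → complete p
    ; bounded = λ _ → z≤n }
    where open IsLinExt le

  LinExtAbove⇒IsLinExt : ∀ {l} → LinExtAbove initial l → IsLinExt n l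
  LinExtAbove⇒IsLinExt L = record
    { each-once = Ordered⇒Unique _≤V_ ≤V-refl ordered
    ; complete  = λ p → covers p z≤n
    ; order     = Ordered⇒order _≤V_ ordered }
    where open LinExtAbove L

  firstBalance : ∀ {κ} u → StrictBallot κ → KrewerasFrom κ u → FirstBalance κ u
  firstBalance [] strict total = contradiction (trans (total 𝔹) (sym (total 𝔸))) (<⇒≢ (strict 𝔹 λ ()))
  firstBalance {κ} (x ∷ u) strict (step , kw) with x ≟L 𝔸 | suc (κ x) ≟ κ 𝔸
  ... | no x≢𝔸  | yes closes = closes-now (x≢𝔸 , closes)
  ... | yes refl | _         = strict-∷ strict′ (firstBalance u strict′ kw)
    where
      strict′ : StrictBallot (tick 𝔸 κ)
      strict′ = StrictBallot-tick strict (λ 𝔸≢𝔸 → contradiction refl 𝔸≢𝔸)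
  ... | no x≢𝔸  | no  κx+1≢κ𝔸 = strict-∷ strict′ (firstBalance u strict′ kw)
    where
      strict′ : StrictBallot (tick x κ)
      strict′ = StrictBallot-tick strict (λ _ → ≤∧≢⇒< (step x≢𝔸) κx+1≢κ𝔸)

  slide-not𝔸 : ∀ {κ X k} u → X ≢ 𝔸 → k < κ 𝔸 → k < κ X → KrewerasFrom κ u →
               erase (slide (cell X k) (label κ u)) ≡ u ++ X ∷ []
  slide-not𝔸 [] _ _ _ _ = refl
  slide-not𝔸 {κ} {X} {k} (Y ∷ u) X≢𝔸 k<κ𝔸 k<κX kw with Y ≟L X
  ... | yes refl = trans (cong erase (slide-comparable _ (inj₁ (cell-≤V ≤L-refl (<⇒≤ k<κX) κY<n))))
                        (cong (Y ∷_) (slide-not𝔸 u X≢𝔸 κY<κ′𝔸 κY<κ′Y (proj₂ kw)))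
    where
      κY<n : κ Y < n
      κY<n = KrewerasFrom-head< u kw
      κY<κ′𝔸 : κ Y < tick Y κ 𝔸
      κY<κ′𝔸 = subst (κ Y <_) (sym (tick-other κ (X≢𝔸 ∘ sym))) (proj₁ kw X≢𝔸)
      κY<κ′Y : κ Y < tick Y κ Y
      κY<κ′Y = subst (κ Y <_) (sym (tick-same Y κ)) ≤-refl
  ... | no Y≢X = trans (cong erase (slide-incomparable _ incomparable))
                       (cong (Y ∷_) (slide-not𝔸 u X≢𝔸 k<κ′𝔸 k<κ′X (proj₂ kw)))
    where
      κY<n : κ Y < n
      κY<n = KrewerasFrom-head< u kw
      k<n : k < n
      k<n = <-≤-trans k<κX (KrewerasFrom-bounded (Y ∷ u) kw X)
      k<κ′𝔸 : k < tick Y κ 𝔸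
      k<κ′𝔸 = <-≤-trans k<κ𝔸 (≤-tick Y κ 𝔸)
      k<κ′X : k < tick Y κ X
      k<κ′X = subst (k <_) (sym (tick-other κ (Y≢X ∘ sym))) k<κX
      incomparable : ¬ (cell X k ≤V cell Y (κ Y) ⊎ cell Y (κ Y) ≤V cell X k)
      incomparable (inj₁ (X≤Y , _)) with ≤L-cases X≤Y
      ... | inj₁ X≡Y       = Y≢X (sym X≡Y)
      ... | inj₂ (X≡𝔸 , _) = X≢𝔸 X≡𝔸
      incomparable (inj₂ Y≤X@(Y≤LX , _)) with ≤L-cases Y≤LX
      ... | inj₁ Y≡X      = Y≢X Y≡X
      ... | inj₂ (refl , _) = <⇒≱ k<κ𝔸 (cell-≤V⁻¹ κY<n k<n Y≤X)

  slide-𝔸 : ∀ {κ k u} (fb : FirstBalance κ u) → κ 𝔸 ≡ suc k → KrewerasFrom κ u →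
            erase (slide (cell 𝔸 k) (label κ u)) ≡ promoted fb
  slide-𝔸 {κ} {k} (closes-now {X} {t} (X≢𝔸 , closes)) κ𝔸≡ kw =
    trans (cong erase (slide-comparable _ (inj₁ (cell-≤V (𝔸≤L X) (≤-reflexive (sym κX≡k)) κX<n))))
          (cong (𝔸 ∷_) (slide-not𝔸 t X≢𝔸 κX<κ′𝔸 κX<κ′X (proj₂ kw)))
    where
      κX≡k : κ X ≡ k
      κX≡k = suc-injective (trans closes κ𝔸≡)
      κX<n : κ X < n
      κX<n = KrewerasFrom-head< t kw
      κX<κ′𝔸 : κ X < tick X κ 𝔸
      κX<κ′𝔸 = subst (κ X <_) (sym (tick-other κ (X≢𝔸 ∘ sym))) (proj₁ kw X≢𝔸)
      κX<κ′X : κ X < tick X κ X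
      κX<κ′X = subst (κ X <_) (sym (tick-same X κ)) ≤-refl
  slide-𝔸 {κ} {k} (strict-∷ {x} {u} strict fb) κ𝔸≡ kw with x ≟L 𝔸
  ... | yes refl = trans (cong erase (slide-comparable _ (inj₁ (cell-≤V A≤A k≤κ𝔸 κ𝔸<n))))
                         (cong (𝔸 ∷_) (slide-𝔸 fb (tick-same 𝔸 κ) (proj₂ kw)))
    where
      κ𝔸<n : κ 𝔸 < n
      κ𝔸<n = KrewerasFrom-head< u kw
      k≤κ𝔸 : k ≤ κ 𝔸
      k≤κ𝔸 = subst (k ≤_) (sym κ𝔸≡) (n≤1+n k)
  ... | no x≢𝔸 = trans (cong erase (slide-incomparable _ incomparable))
                       (cong (x ∷_) (slide-𝔸 fb (trans (tick-other κ (x≢𝔸 ∘ sym)) κ𝔸≡) (proj₂ kw)))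
    where
      κx<n : κ x < n
      κx<n = KrewerasFrom-head< u kw
      k<n : k < n
      k<n = subst (_≤ n) κ𝔸≡ (KrewerasFrom-bounded (x ∷ u) kw 𝔸)
      κx<k : κ x < k
      κx<k = ≤-pred (subst₂ _<_ (tick-same x κ) (trans (tick-other κ (x≢𝔸 ∘ sym)) κ𝔸≡) (strict x x≢𝔸))
      incomparable : ¬ (cell 𝔸 k ≤V cell x (κ x) ⊎ cell x (κ x) ≤V cell 𝔸 k)
      incomparable (inj₁ 𝔸≤x) = <⇒≱ κx<k (cell-≤V⁻¹ k<n κx<n 𝔸≤x)
      incomparable (inj₂ (x≤𝔸 , _)) with ≤L-cases x≤𝔸
      ... | inj₁ x≡𝔸       = x≢𝔸 x≡𝔸
      ... | inj₂ (x≡𝔸 , _) = x≢𝔸 x≡𝔸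

  promotion-label : ∀ w → KrewerasFrom initial w → erase (proV (label initial w)) ≡ proK w
  promotion-label [] total = contradiction (sym (total 𝔸)) (≢-nonZero⁻¹ n)
  promotion-label (x ∷ u) kw with x ≟L 𝔸
  ... | no x≢𝔸  = contradiction (proj₁ kw x≢𝔸) λ ()
  ... | yes refl = begin
    erase (proV (cell 𝔸 0 ∷ label (tick 𝔸 initial) u)) ≡⟨ cong erase (proV-∷ (cell 𝔸 0) (label _ u)) ⟩
    erase (slide (cell 𝔸 0) (label (tick 𝔸 initial) u)) ≡⟨ slide-𝔸 fb refl (proj₂ kw) ⟩
    promoted fb                                         ≡⟨ sym (proK-𝔸∷ fb) ⟩
    proK (𝔸 ∷ u)                                        ∎
    where
      open ≡-Reasoning
      fb : FirstBalance (tick 𝔸 initial) u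
      fb = firstBalance u StrictBallot-𝔸 (proj₂ kw)

proposition2p2 : (n : ℕ) → 1 ≤ n →
    -- erase maps linear extensions of V(n) to Kreweras words of length 3n
    ((l : List (V n)) → IsLinExt n l → IsKreweras n (erase l))
    -- injective on linear extensions
    × ((l l′ : List (V n)) → IsLinExt n l → IsLinExt n l′ → erase l ≡ erase l′ → l ≡ l′)
    -- surjective onto Kreweras words
    × ((w : List Letter) → IsKreweras n w → Σ (List (V n)) (λ l → IsLinExt n l × erase l ≡ w))
    -- promotion is intertwined
    × ((l : List (V n)) → IsLinExt n l → erase (proV l) ≡ proK (erase l))
proposition2p2 n 1≤n = kreweras , injective , surjective , promotion
  where
    open Labelling n {{>-nonZero 1≤n}}
    labelled : ∀ {l} → IsLinExt n l → l ≡ label initial (erase l) × KrewerasFrom initial (erase l)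
    labelled {l} le = LinExtAbove⇒label l (IsLinExt⇒LinExtAbove le)
    kreweras : (l : List (V n)) → IsLinExt n l → IsKreweras n (erase l)
    kreweras l le = KrewerasFrom⇒IsKreweras (proj₂ (labelled le))
    injective : (l l′ : List (V n)) → IsLinExt n l → IsLinExt n l′ → erase l ≡ erase l′ → l ≡ l′
    injective l l′ le le′ e =
      trans (proj₁ (labelled le)) (trans (cong (label initial) e) (sym (proj₁ (labelled le′))))
    surjective : (w : List Letter) → IsKreweras n w → Σ (List (V n)) (λ l → IsLinExt n l × erase l ≡ w)
    surjective w K = label initial w
                   , LinExtAbove⇒IsLinExt (label-LinExtAbove w (IsKreweras⇒KrewerasFrom K))
                   , erase-label initial w
    promotion : (l : List (V n)) → IsLinExt n l → erase (proV l) ≡ proK (erase l)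
    promotion l le =
      trans (cong (erase ∘ proV) (proj₁ (labelled le))) (promotion-label (erase l) (proj₂ (labelled le)))
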